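{- Let $p$ be a prime and $n\geq 1$. Then for every integer $i$ and every $j\in\{0,\dots,p^{n+1}-1\}$, $\widetilde{\mathcal{G}}_{p,n}(ip^{n+1}+j)\equiv\widetilde{\mathcal{G}}_{p,n}(j)\pmod p$; i.e., $x\mapsto \widetilde{\mathcal{G}}_{p,n}(x)\bmod p$ is periodic with period $p^{n+1}$.
   Context: For a prime $p$: $\widetilde{\mathcal{G}}_{p,0}(x)=x$ and $\widetilde{\mathcal{G}}_{p,n}(x)=\frac{1}{p}\prod_{i=0}^{p-1}\left(\widetilde{\mathcal{G}}_{p,n-1}(x)-i\right)$ for $n\geq 1$; these rational polynomials take integer values at all integers. -}

module Defs where

open import Data.Nat as ℕ using (ℕ; zero; suc; NonZero)
open import Data.Integer as ℤ using (ℤ; +_)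
open import Data.Rational using (ℚ; _/_; _*_; _-_; 1ℚ)
open import Data.Product using (∃)
open import Relation.Binary.PropositionalEquality using (_≡_)
open import Data.List using (List; foldr; map; upTo)

ℤtoℚ : ℤ → ℚ
ℤtoℚ i = i / 1

fallingProd : ℕ → ℚ → ℚ
fallingProd p y = foldr _*_ 1ℚ (map (λ i → y - ℤtoℚ (+ i)) (upTo p))

Gt : (p : ℕ) → .{{_ : NonZero p}} → ℕ → ℚ → ℚ
Gt p zero    x = x
Gt p (suc n) x = ((+ 1) / p) * fallingProd p (Gt p n x)

-- Congruence mod p of two rationals: their difference is p times an integer.
-- (For integer-valued a, b this is exactly a ≡ b (mod p).)
_≡ℚ_[mod_] : ℚ → ℚ → ℕ → Set
a ≡ℚ b [mod p ] = ∃ λ (k : ℤ) → a - b ≡ ℤtoℚ ((+ p) ℤ.* k)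

-- All the values involved are integers: writing G for the integer sequence
-- G₀(x) = x, p · Gₖ₊₁(x) = ∏_{i<p} (Gₖ(x) − i) (exact because one of p
-- consecutive integers is divisible by p), G̃_{p,n} is the image of G_n in ℚ.
-- If a ≡ b (mod p^{m+1}) then each factor Gₖ(a) − i is congruent to
-- Gₖ(b) − i, hence so are the products, and dividing by p leaves
-- Gₖ₊₁(a) ≡ Gₖ₊₁(b) (mod p^m). Iterating n times from modulus p^{n+1}
-- gives the claim.
module Submission where

open import Defs
open import Data.Nat as ℕ using (ℕ; NonZero; _≥_; _<_; _^_)
open import Data.Nat.Primality using (Prime)
open import Data.Integer as ℤ using (ℤ; +_)
import Data.Nat.Properties as ℕ
import Data.Integer.Properties as ℤ
open import Data.Integer.Divisibility.Signed
  using (_∣_; divides; ∣m∣n⇒∣m+n; ∣n⇒∣m*n; ∣m⇒∣m*n; *-cancelˡ-∣)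
open import Data.Integer.DivMod using (_%ℕ_; _/ℕ_; a≡a%ℕn+[a/ℕn]*n; n%ℕd<d)
open import Data.Integer.Tactic.RingSolver using (solve-∀)
open import Data.Rational as ℚ using (toℚᵘ; 1ℚ)
open import Data.Rational.Properties
  using (toℚᵘ-injective; toℚᵘ-fromℚᵘ; toℚᵘ-homo-*; toℚᵘ-homo-+; toℚᵘ-homo‿-)
open import Data.Rational.Unnormalised as ℚᵘ using (mkℚᵘ; *≡*; _≃_)
import Data.Rational.Unnormalised.Properties as ℚᵘ
open import Data.Product using (_,_)
open import Data.List using (List; []; _∷_; foldr; map; upTo)
open import Data.List.Membership.Propositional using (_∈_)
open import Data.List.Membership.Propositional.Properties using (∈-upTo⁺)
open import Data.List.Relation.Unary.Any using (here; there)
open import Relation.Binary.PropositionalEquality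

ℤtoℚ-toℚᵘ : ∀ i → toℚᵘ (ℤtoℚ i) ≃ mkℚᵘ i 0
ℤtoℚ-toℚᵘ i = toℚᵘ-fromℚᵘ (mkℚᵘ i 0)

ℤtoℚ-homo-minus : ∀ a b → ℤtoℚ (a ℤ.- b) ≡ ℤtoℚ a ℚ.- ℤtoℚ b
ℤtoℚ-homo-minus a b = toℚᵘ-injective (begin
  toℚᵘ (ℤtoℚ (a ℤ.- b))                 ≈⟨ ℤtoℚ-toℚᵘ (a ℤ.- b) ⟩
  mkℚᵘ (a ℤ.- b) 0                       ≈⟨ *≡* (minus-over-1 a b) ⟩
  mkℚᵘ a 0 ℚᵘ.- mkℚᵘ b 0                 ≈⟨ ℚᵘ.+-cong (ℤtoℚ-toℚᵘ a) (ℚᵘ.-‿cong (ℤtoℚ-toℚᵘ b)) ⟨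
  toℚᵘ (ℤtoℚ a) ℚᵘ.- toℚᵘ (ℤtoℚ b)       ≈⟨ ℚᵘ.+-congʳ (toℚᵘ (ℤtoℚ a)) (toℚᵘ-homo‿- (ℤtoℚ b)) ⟨
  toℚᵘ (ℤtoℚ a) ℚᵘ.+ toℚᵘ (ℚ.- ℤtoℚ b)   ≈⟨ toℚᵘ-homo-+ (ℤtoℚ a) (ℚ.- ℤtoℚ b) ⟨
  toℚᵘ (ℤtoℚ a ℚ.- ℤtoℚ b)               ∎)
  where
  open ℚᵘ.≃-Reasoning
  minus-over-1 : ∀ a b → (a ℤ.- b) ℤ.* + 1 ≡ (a ℤ.* + 1 ℤ.+ (ℤ.- b) ℤ.* + 1) ℤ.* + 1
  minus-over-1 = solve-∀

ℤtoℚ-homo-* : ∀ a b → ℤtoℚ (a ℤ.* b) ≡ ℤtoℚ a ℚ.* ℤtoℚ b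
ℤtoℚ-homo-* a b = toℚᵘ-injective (begin
  toℚᵘ (ℤtoℚ (a ℤ.* b))                 ≈⟨ ℤtoℚ-toℚᵘ (a ℤ.* b) ⟩
  mkℚᵘ a 0 ℚᵘ.* mkℚᵘ b 0                 ≈⟨ ℚᵘ.*-cong (ℤtoℚ-toℚᵘ a) (ℤtoℚ-toℚᵘ b) ⟨
  toℚᵘ (ℤtoℚ a) ℚᵘ.* toℚᵘ (ℤtoℚ b)       ≈⟨ toℚᵘ-homo-* (ℤtoℚ a) (ℤtoℚ b) ⟨
  toℚᵘ (ℤtoℚ a ℚ.* ℤtoℚ b)               ∎)
  where open ℚᵘ.≃-Reasoning

1/n*ℤtoℚ[m*n]≡ℤtoℚ[m] : ∀ n .{{_ : NonZero n}} m → (+ 1 ℚ./ n) ℚ.* ℤtoℚ (m ℤ.* + n) ≡ ℤtoℚ m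
1/n*ℤtoℚ[m*n]≡ℤtoℚ[m] n@(ℕ.suc n-1) m = toℚᵘ-injective (begin
  toℚᵘ ((+ 1 ℚ./ n) ℚ.* ℤtoℚ (m ℤ.* + n))       ≈⟨ toℚᵘ-homo-* (+ 1 ℚ./ n) (ℤtoℚ (m ℤ.* + n)) ⟩
  toℚᵘ (+ 1 ℚ./ n) ℚᵘ.* toℚᵘ (ℤtoℚ (m ℤ.* + n))  ≈⟨ ℚᵘ.*-cong (toℚᵘ-fromℚᵘ (mkℚᵘ (+ 1) n-1)) (ℤtoℚ-toℚᵘ (m ℤ.* + n)) ⟩
  mkℚᵘ (+ 1) n-1 ℚᵘ.* mkℚᵘ (m ℤ.* + n) 0         ≈⟨ *≡* (trans (unit-factors m (+ n)) (cong (m ℤ.*_) (sym (ℤ.pos-* n 1)))) ⟩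
  mkℚᵘ m 0                                       ≈⟨ ℤtoℚ-toℚᵘ m ⟨
  toℚᵘ (ℤtoℚ m)                                  ∎)
  where
  open ℚᵘ.≃-Reasoning
  unit-factors : ∀ m k → (+ 1 ℤ.* (m ℤ.* k)) ℤ.* + 1 ≡ m ℤ.* (k ℤ.* + 1)
  unit-factors = solve-∀

shiftedProduct : List ℕ → ℤ → ℤ
shiftedProduct is x = foldr ℤ._*_ (+ 1) (map (λ i → x ℤ.- + i) is)

ℤtoℚ-shiftedProduct : ∀ is x →
  foldr ℚ._*_ 1ℚ (map (λ i → ℤtoℚ x ℚ.- ℤtoℚ (+ i)) is) ≡ ℤtoℚ (shiftedProduct is x)
ℤtoℚ-shiftedProduct []       x = refl
ℤtoℚ-shiftedProduct (i ∷ is) x = begin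
  (ℤtoℚ x ℚ.- ℤtoℚ (+ i)) ℚ.* foldr ℚ._*_ 1ℚ (map (λ i → ℤtoℚ x ℚ.- ℤtoℚ (+ i)) is)
                                                  ≡⟨ cong₂ ℚ._*_ (sym (ℤtoℚ-homo-minus x (+ i))) (ℤtoℚ-shiftedProduct is x) ⟩
  ℤtoℚ (x ℤ.- + i) ℚ.* ℤtoℚ (shiftedProduct is x) ≡⟨ ℤtoℚ-homo-* (x ℤ.- + i) (shiftedProduct is x) ⟨
  ℤtoℚ (shiftedProduct (i ∷ is) x)                ∎
  where open ≡-Reasoning

shiftedProduct-cong : ∀ {m} is a b → m ∣ a ℤ.- b → m ∣ shiftedProduct is a ℤ.- shiftedProduct is b
shiftedProduct-cong []       _ _ _ = divides (+ 0) refl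
shiftedProduct-cong {m} (i ∷ is) a b m∣a-b =
  subst (m ∣_) (sym (product-difference a b (+ i) (shiftedProduct is a) (shiftedProduct is b)))
    (∣m∣n⇒∣m+n (∣n⇒∣m*n (a ℤ.- + i) (shiftedProduct-cong is a b m∣a-b))
               (∣m⇒∣m*n (shiftedProduct is b) m∣a-b))
  where
  product-difference : ∀ a b i P Q →
    (a ℤ.- i) ℤ.* P ℤ.- (b ℤ.- i) ℤ.* Q ≡ (a ℤ.- i) ℤ.* (P ℤ.- Q) ℤ.+ (a ℤ.- b) ℤ.* Q
  product-difference = solve-∀

∣factor⇒∣shiftedProduct : ∀ {m r is} x → r ∈ is → m ∣ x ℤ.- + r → m ∣ shiftedProduct is x
∣factor⇒∣shiftedProduct {is = i ∷ is} x (here refl) m∣x-r = ∣m⇒∣m*n (shiftedProduct is x) m∣x-r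
∣factor⇒∣shiftedProduct {is = i ∷ is} x (there r∈is) m∣x-r =
  ∣n⇒∣m*n (x ℤ.- + i) (∣factor⇒∣shiftedProduct x r∈is m∣x-r)

n∣shiftedProduct[upTo-n] : ∀ n .{{_ : NonZero n}} x → + n ∣ shiftedProduct (upTo n) x
n∣shiftedProduct[upTo-n] n x =
  ∣factor⇒∣shiftedProduct x (∈-upTo⁺ (n%ℕd<d x n))
    (divides (x /ℕ n) (trans (cong (ℤ._- r) (a≡a%ℕn+[a/ℕn]*n x n)) (remainder-cancels r (x /ℕ n) (+ n))))
  where
  r : ℤ
  r = + (x %ℕ n)
  remainder-cancels : ∀ r q n → (r ℤ.+ q ℤ.* n) ℤ.- r ≡ q ℤ.* n
  remainder-cancels = solve-∀

module _ (p : ℕ) .{{_ : NonZero p}} where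

  G : ℕ → ℤ → ℤ
  G ℕ.zero    x = x
  G (ℕ.suc k) x = _∣_.quotient (n∣shiftedProduct[upTo-n] p (G k x))

  shiftedProduct-G : ∀ k x → shiftedProduct (upTo p) (G k x) ≡ G (ℕ.suc k) x ℤ.* + p
  shiftedProduct-G k x = _∣_.equality (n∣shiftedProduct[upTo-n] p (G k x))

  Gt-ℤtoℚ : ∀ k x → Gt p k (ℤtoℚ x) ≡ ℤtoℚ (G k x)
  Gt-ℤtoℚ ℕ.zero    x = refl
  Gt-ℤtoℚ (ℕ.suc k) x = begin
    (+ 1 ℚ./ p) ℚ.* fallingProd p (Gt p k (ℤtoℚ x))  ≡⟨ cong (λ y → (+ 1 ℚ./ p) ℚ.* fallingProd p y) (Gt-ℤtoℚ k x) ⟩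
    (+ 1 ℚ./ p) ℚ.* fallingProd p (ℤtoℚ (G k x))     ≡⟨ cong ((+ 1 ℚ./ p) ℚ.*_) (ℤtoℚ-shiftedProduct (upTo p) (G k x)) ⟩
    (+ 1 ℚ./ p) ℚ.* ℤtoℚ (shiftedProduct (upTo p) (G k x)) ≡⟨ cong (λ y → (+ 1 ℚ./ p) ℚ.* ℤtoℚ y) (shiftedProduct-G k x) ⟩
    (+ 1 ℚ./ p) ℚ.* ℤtoℚ (G (ℕ.suc k) x ℤ.* + p)     ≡⟨ 1/n*ℤtoℚ[m*n]≡ℤtoℚ[m] p (G (ℕ.suc k) x) ⟩
    ℤtoℚ (G (ℕ.suc k) x)                             ∎
    where open ≡-Reasoning

  G-suc-cong : ∀ k m a b → + (p ^ ℕ.suc m) ∣ G k a ℤ.- G k b →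
               + (p ^ m) ∣ G (ℕ.suc k) a ℤ.- G (ℕ.suc k) b
  G-suc-cong k m a b h = *-cancelˡ-∣ (+ p) (subst₂ _∣_ (ℤ.pos-* p (p ^ m)) difference
    (shiftedProduct-cong (upTo p) (G k a) (G k b) h))
    where
    factor-out : ∀ u v n → u ℤ.* n ℤ.- v ℤ.* n ≡ n ℤ.* (u ℤ.- v)
    factor-out = solve-∀
    difference : shiftedProduct (upTo p) (G k a) ℤ.- shiftedProduct (upTo p) (G k b)
               ≡ + p ℤ.* (G (ℕ.suc k) a ℤ.- G (ℕ.suc k) b)
    difference = trans (cong₂ ℤ._-_ (shiftedProduct-G k a) (shiftedProduct-G k b))
                       (factor-out (G (ℕ.suc k) a) (G (ℕ.suc k) b) (+ p))

  G-cong : ∀ k m a b → + (p ^ (m ℕ.+ k)) ∣ a ℤ.- b → + (p ^ m) ∣ G k a ℤ.- G k b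
  G-cong ℕ.zero    m a b h = subst (λ e → + (p ^ e) ∣ a ℤ.- b) (ℕ.+-identityʳ m) h
  G-cong (ℕ.suc k) m a b h = G-suc-cong k m a b
    (G-cong k (ℕ.suc m) a b (subst (λ e → + (p ^ e) ∣ a ℤ.- b) (ℕ.+-suc m k) h))

∣⇒≡ℚ-mod : ∀ {n} a b → + n ∣ a ℤ.- b → ℤtoℚ a ≡ℚ ℤtoℚ b [mod n ]
∣⇒≡ℚ-mod {n} a b (divides q a-b≡q*n) = q , (begin
  ℤtoℚ a ℚ.- ℤtoℚ b  ≡⟨ ℤtoℚ-homo-minus a b ⟨
  ℤtoℚ (a ℤ.- b)     ≡⟨ cong ℤtoℚ (trans a-b≡q*n (ℤ.*-comm q (+ n))) ⟩
  ℤtoℚ (+ n ℤ.* q)   ∎)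
  where open ≡-Reasoning

mainTheorem18 : (p : ℕ) → .{{_ : NonZero p}} → Prime p → (n : ℕ) → n ≥ 1 →
    (i : ℤ) → (j : ℕ) → j < p ^ (ℕ.suc n) →
    Gt p n (ℤtoℚ (i ℤ.* (+ (p ^ ℕ.suc n)) ℤ.+ (+ j))) ≡ℚ Gt p n (ℤtoℚ (+ j)) [mod p ]
mainTheorem18 p _ n _ i j _ =
  subst₂ (λ u v → u ≡ℚ v [mod p ]) (sym (Gt-ℤtoℚ p n x)) (sym (Gt-ℤtoℚ p n (+ j)))
    (∣⇒≡ℚ-mod (G p n x) (G p n (+ j)) p∣Gx-Gj)
  where
  x : ℤ
  x = i ℤ.* + (p ^ ℕ.suc n) ℤ.+ + j
  shift-cancels : ∀ i q j → (i ℤ.* q ℤ.+ j) ℤ.- j ≡ i ℤ.* q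
  shift-cancels = solve-∀
  p^[n+1]∣x-j : + (p ^ ℕ.suc n) ∣ x ℤ.- + j
  p^[n+1]∣x-j = divides i (shift-cancels i (+ (p ^ ℕ.suc n)) (+ j))
  p∣Gx-Gj : + p ∣ G p n x ℤ.- G p n (+ j)
  p∣Gx-Gj = subst (λ d → + d ∣ G p n x ℤ.- G p n (+ j)) (ℕ.^-identityʳ p)
    (G-cong p n 1 x (+ j) p^[n+1]∣x-j)
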